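{- Let $\mathbb{F}$ be a field and $A_1,\ldots,A_k$ be $n\times n$ matrices over $\mathbb{F}$. Then $\operatorname{rank}\left(\left[\begin{smallmatrix}I_n & 0_n\\ 0_n & I_n\end{smallmatrix}\,\middle|\,\begin{smallmatrix}0_n & 0_n\\ A_1 & 0_n\end{smallmatrix}\,\middle|\cdots\middle|\,\begin{smallmatrix}0_n & 0_n\\ A_k & 0_n\end{smallmatrix}\right]\right)\ge\operatorname{rank}([A_1|\cdots|A_k])+2n$ and $\operatorname{rank}\left(\left[\begin{smallmatrix}0 & 0 & 0\\ I_n & 0_n & 0\\ 0_n & I_n & 0\end{smallmatrix}\,\middle|\,\begin{smallmatrix}0 & 0 & 0\\ 0_n & 0_n & 0\\ A_1 & 0_n & 0\end{smallmatrix}\,\middle|\cdots\middle|\,\begin{smallmatrix}0 & 0 & 0\\ 0_n & 0_n & 0\\ A_k & 0_n & 0\end{smallmatrix}\right]\right)\ge\operatorname{rank}([A_1|\cdots|A_k])+2n,$ where in the second inequality each layer is a $(2n+1)\times(2n+1)$ matrix whose first block row is a single row and last block column a single column, so the left side is the rank of a $[2n+1]\times[2n+1]\times[k+1]$ tensor.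
   Context: $I_n,0_n$ are the $n\times n$ identity and zero matrices. For equal-size matrices $M_1,\ldots,M_m$, $[M_1|\cdots|M_m]$ denotes the order-3 tensor $T(i,j,l)=M_l(i,j)$. A tensor is simple if $T(i_1,i_2,i_3)=\prod_j\vec v_j(i_j)$ for vectors $\vec v_j$; rank (over $\mathbb{F}$) is the minimum number of simple tensors summing to $T$. -}

module Defs where

open import Level using (Level; _⊔_)
open import Algebra.Bundles using (CommutativeRing)
open import Data.Nat as ℕ using (ℕ; zero; suc; _≤_)
open import Data.Fin using (Fin; zero; suc; splitAt; _≟_)
open import Data.Sum using (_⊎_; inj₁; inj₂)
open import Data.Product using (Σ; ∃; _×_; _,_)
open import Relation.Nullary using (¬_; does)
open import Data.Bool using (if_then_else_)

record Field (c ℓ : Level) : Set (Level.suc (c ⊔ ℓ)) where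
  field
    commutativeRing : CommutativeRing c ℓ
  open CommutativeRing commutativeRing public
  field
    1≉0     : ¬ (1# ≈ 0#)
    inverse : ∀ x → ¬ (x ≈ 0#) → Σ Carrier (λ y → x * y ≈ 1#)

module _ {c ℓ : Level} (F : Field c ℓ) where
  open Field F using (Carrier; _≈_; _+_; _*_; 0#; 1#)

  Matrix : ℕ → ℕ → Set c
  Matrix a b = Fin a → Fin b → Carrier

  Tensor : ℕ → ℕ → ℕ → Set c
  Tensor a b d = Fin a → Fin b → Fin d → Carrier

  Σ[<_]_ : (r : ℕ) → (Fin r → Carrier) → Carrier
  Σ[< zero ] f = 0#
  Σ[< suc r ] f = f zero + Σ[< r ] (λ t → f (suc t))

  SumOfSimple : ∀ {a b d} → Tensor a b d → ℕ → Set (c ⊔ ℓ)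
  SumOfSimple {a} {b} {d} T r =
    Σ (Fin r → Fin a → Carrier) λ u →
    Σ (Fin r → Fin b → Carrier) λ v →
    Σ (Fin r → Fin d → Carrier) λ w →
      ∀ i j l → T i j l ≈ (Σ[< r ] λ t → u t i * v t j * w t l)

  IsRank : ∀ {a b d} → Tensor a b d → ℕ → Set (c ⊔ ℓ)
  IsRank T r = SumOfSimple T r × (∀ s → SumOfSimple T s → r ≤ s)

  layers : ∀ {a b m} → (Fin m → Matrix a b) → Tensor a b m
  layers M i j l = M l i j

  δ : ∀ {n} → Fin n → Fin n → Carrier
  δ i j = if does (i ≟ j) then 1# else 0#

  blockI : ∀ {n} → Matrix (n ℕ.+ n) (n ℕ.+ n)
  blockI {n} i j with splitAt n i | splitAt n j
  ... | inj₁ i' | inj₁ j' = δ i' j'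
  ... | inj₂ i' | inj₂ j' = δ i' j'
  ... | _       | _       = 0#

  blockA : ∀ {n} → Matrix n n → Matrix (n ℕ.+ n) (n ℕ.+ n)
  blockA {n} A i j with splitAt n i | splitAt n j
  ... | inj₂ i' | inj₁ j' = A i' j'
  ... | _       | _       = 0#

  tensor₁ : ∀ {n k} → (Fin k → Matrix n n) → Tensor (n ℕ.+ n) (n ℕ.+ n) (suc k)
  tensor₁ {n} A = layers λ { zero → blockI {n} ; (suc t) → blockA (A t) }

  -- Rows are split into blocks of
  -- sizes 1, n, n; columns into blocks of sizes n, n, 1. Layers
  --   [[0,0,0],[I,0,0],[0,I,0]] , [[0,0,0],[0,0,0],[A_t,0,0]]
  rowBlocks : ∀ n → Fin (1 ℕ.+ (n ℕ.+ n)) → Fin 1 ⊎ (Fin n ⊎ Fin n)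
  rowBlocks n i with splitAt 1 i
  ... | inj₁ x = inj₁ x
  ... | inj₂ y = inj₂ (splitAt n y)

  colBlocks : ∀ n → Fin ((n ℕ.+ n) ℕ.+ 1) → (Fin n ⊎ Fin n) ⊎ Fin 1
  colBlocks n j with splitAt (n ℕ.+ n) j
  ... | inj₁ x = inj₁ (splitAt n x)
  ... | inj₂ y = inj₂ y

  blockI' : ∀ {n} → Matrix (1 ℕ.+ (n ℕ.+ n)) ((n ℕ.+ n) ℕ.+ 1)
  blockI' {n} i j with rowBlocks n i | colBlocks n j
  ... | inj₂ (inj₁ i') | inj₁ (inj₁ j') = δ i' j'
  ... | inj₂ (inj₂ i') | inj₁ (inj₂ j') = δ i' j'
  ... | _              | _              = 0#

  blockA' : ∀ {n} → Matrix n n → Matrix (1 ℕ.+ (n ℕ.+ n)) ((n ℕ.+ n) ℕ.+ 1)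
  blockA' {n} A i j with rowBlocks n i | colBlocks n j
  ... | inj₂ (inj₂ i') | inj₁ (inj₁ j') = A i' j'
  ... | _              | _              = 0#

  tensor₂ : ∀ {n k} → (Fin k → Matrix n n) → Tensor (1 ℕ.+ (n ℕ.+ n)) ((n ℕ.+ n) ℕ.+ 1) (suc k)
  tensor₂ {n} A = layers λ { zero → blockI' {n} ; (suc t) → blockA' (A t) }

-- Substitution method. If a decomposition of T into r simple tensors u_t ⊗ v_t ⊗ w_t
-- exists and the slice T(0,·,·) is nonzero, then some term has u_t(0) ≠ 0; adding
-- suitable multiples of slice 0 to the other slices cancels that term, so the remaining
-- slices form a tensor of rank at most r − 1, and it agrees with T wherever slice 0
-- vanishes. The identity layer of the first tensor supplies n such pivots among the
-- upper rows and, after transposing, n more among the right columns; what is left is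
-- [A_1|⋯|A_k]. The second tensor contains the first as a subtensor.
module Submission where

open import Defs
open import Level using (Level)
open import Data.Nat as ℕ using (ℕ; _≤_; _≤?_)
open import Data.Nat.Properties using (+-monoˡ-≤)
open import Data.Fin using (Fin; zero; suc; _↑ˡ_; _↑ʳ_; splitAt; join; punchIn)
open import Data.Fin.Properties using (splitAt-↑ˡ; splitAt-↑ʳ)
open import Data.Product using (∃-syntax; _×_; _,_; proj₁; proj₂)
open import Data.Sum as Sum using (inj₁; inj₂)
open import Function using (_∘_; id)
open import Relation.Nullary using (¬_)
open import Relation.Nullary.Negation using (¬¬-map; negated-stable; contradiction)
open import Relation.Nullary.Decidable using (decidable-stable)
open import Relation.Binary.PropositionalEquality as ≡ using (_≡_)

swapBlocks : ∀ n → Fin (n ℕ.+ n) → Fin (n ℕ.+ n)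
swapBlocks n = join n n ∘ Sum.swap ∘ splitAt n

swapBlocks-↑ˡ : ∀ {n} (p : Fin n) → swapBlocks n (p ↑ˡ n) ≡ n ↑ʳ p
swapBlocks-↑ˡ {n} p rewrite splitAt-↑ˡ n p n = ≡.refl

swapBlocks-↑ʳ : ∀ {n} (p : Fin n) → swapBlocks n (n ↑ʳ p) ≡ p ↑ˡ n
swapBlocks-↑ʳ {n} p rewrite splitAt-↑ʳ n n p = ≡.refl

module RankBounds {c ℓ : Level} (F : Field c ℓ) where
  open Field F hiding (zero)
  open import Algebra.Properties.Ring ring using (-‿distribˡ-*)
  open import Algebra.Properties.CommutativeSemigroup +-commutativeSemigroup
    using (interchange; x∙yz≈y∙xz)
  open import Relation.Binary.Reasoning.Setoid setoid

  -- Equality in F is not decidable, so a pivot is only found under double negation.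
  private
    _>>=_ : ∀ {a b} {A : Set a} {B : Set b} → ¬ ¬ A → (A → ¬ ¬ B) → ¬ ¬ B
    ¬¬a >>= f = negated-stable (¬¬-map f ¬¬a)

    return : ∀ {a} {A : Set a} → A → ¬ ¬ A
    return a ¬a = ¬a a

  ∑ : (r : ℕ) → (Fin r → Carrier) → Carrier
  ∑ = Σ[<_]_ F

  ∑-cong : ∀ r {f g : Fin r → Carrier} → (∀ t → f t ≈ g t) → ∑ r f ≈ ∑ r g
  ∑-cong ℕ.zero    f≈g = refl
  ∑-cong (ℕ.suc r) f≈g = +-cong (f≈g zero) (∑-cong r (f≈g ∘ suc))

  ∑-linear : ∀ r (f g : Fin r → Carrier) k → ∑ r f + k * ∑ r g ≈ ∑ r (λ t → f t + k * g t)
  ∑-linear ℕ.zero    f g k = trans (+-congˡ (zeroʳ k)) (+-identityˡ 0#)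
  ∑-linear (ℕ.suc r) f g k = begin
      (f zero + ∑ r (f ∘ suc)) + k * (g zero + ∑ r (g ∘ suc))
    ≈⟨ +-congˡ (distribˡ k (g zero) _) ⟩
      (f zero + ∑ r (f ∘ suc)) + (k * g zero + k * ∑ r (g ∘ suc))
    ≈⟨ interchange _ _ _ _ ⟩
      (f zero + k * g zero) + (∑ r (f ∘ suc) + k * ∑ r (g ∘ suc))
    ≈⟨ +-congˡ (∑-linear r (f ∘ suc) (g ∘ suc) k) ⟩
      (f zero + k * g zero) + ∑ r (λ t → f (suc t) + k * g (suc t))
    ∎

  ∑-punchIn : ∀ r (t : Fin (ℕ.suc r)) (f : Fin (ℕ.suc r) → Carrier) →
              ∑ (ℕ.suc r) f ≈ f t + ∑ r (f ∘ punchIn t)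
  ∑-punchIn r         zero    f = refl
  ∑-punchIn (ℕ.suc r) (suc t) f = trans (+-congˡ (∑-punchIn r t (f ∘ suc))) (x∙yz≈y∙xz _ _ _)

  ∑≉0⇒∃≉0 : ∀ r (f : Fin r → Carrier) → ¬ ∑ r f ≈ 0# → ¬ ¬ (∃[ t ] ¬ f t ≈ 0#)
  ∑≉0⇒∃≉0 ℕ.zero    f ∑≉0 _ = ∑≉0 refl
  ∑≉0⇒∃≉0 (ℕ.suc r) f ∑≉0 ∄ = head≉0 λ head≈0 →
    ∑≉0⇒∃≉0 r (f ∘ suc) (λ tail≈0 → ∑≉0 (trans (+-cong head≈0 tail≈0) (+-identityˡ 0#)))
      (λ (t , f[1+t]≉0) → ∄ (suc t , f[1+t]≉0))
    where
    head≉0 : ¬ ¬ f zero ≈ 0#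
    head≉0 f₀≉0 = ∄ (zero , f₀≉0)

  x≈0⇒x*y*z≈0 : ∀ {x} y z → x ≈ 0# → x * y * z ≈ 0#
  x≈0⇒x*y*z≈0 y z x≈0 = trans (*-congʳ (trans (*-congʳ x≈0) (zeroˡ y))) (zeroˡ z)

  y≈0⇒x+k*y≈x : ∀ x k {y} → y ≈ 0# → x + k * y ≈ x
  y≈0⇒x+k*y≈x x k y≈0 = trans (+-congˡ (trans (*-congˡ y≈0) (zeroʳ k))) (+-identityʳ x)

  xyz+k[wyz]≈[x+kw]yz : ∀ x y z k w → x * y * z + k * (w * y * z) ≈ (x + k * w) * y * z
  xyz+k[wyz]≈[x+kw]yz x y z k w = begin
      x * y * z + k * (w * y * z)
    ≈⟨ +-congˡ (trans (sym (*-assoc k (w * y) z)) (*-congʳ (sym (*-assoc k w y)))) ⟩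
      x * y * z + k * w * y * z
    ≈⟨ sym (distribʳ z (x * y) (k * w * y)) ⟩
      (x * y + k * w * y) * z
    ≈⟨ *-congʳ (sym (distribʳ y x (k * w))) ⟩
      (x + k * w) * y * z
    ∎

  x+[-xβ]α≈0 : ∀ x {α β} → α * β ≈ 1# → x + - (x * β) * α ≈ 0#
  x+[-xβ]α≈0 x {α} {β} αβ≈1 = begin
      x + - (x * β) * α   ≈⟨ +-congˡ (sym (-‿distribˡ-* (x * β) α)) ⟩
      x + - (x * β * α)   ≈⟨ +-congˡ (-‿cong xβα≈x) ⟩
      x + - x             ≈⟨ -‿inverseʳ x ⟩
      0#                  ∎
    where
    xβα≈x : x * β * α ≈ x
    xβα≈x = begin
      x * β * α   ≈⟨ *-assoc x β α ⟩
      x * (β * α) ≈⟨ *-congˡ (trans (*-comm β α) αβ≈1) ⟩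
      x * 1#      ≈⟨ *-identityʳ x ⟩
      x           ∎

  SumOfSimple-resp : ∀ {a b d} {T T′ : Tensor F a b d} {r} →
                     (∀ i j l → T′ i j l ≈ T i j l) → SumOfSimple F T r → SumOfSimple F T′ r
  SumOfSimple-resp T′≈T (u , v , w , eq) = u , v , w , λ i j l → trans (T′≈T i j l) (eq i j l)

  SumOfSimple-reindex : ∀ {a b d a′ b′ d′} {T : Tensor F a b d} {r}
                        (σ : Fin a′ → Fin a) (τ : Fin b′ → Fin b) (ρ : Fin d′ → Fin d) →
                        SumOfSimple F T r → SumOfSimple F (λ i j l → T (σ i) (τ j) (ρ l)) r
  SumOfSimple-reindex σ τ ρ (u , v , w , eq) =
    (λ t → u t ∘ σ) , (λ t → v t ∘ τ) , (λ t → w t ∘ ρ) , λ i j l → eq (σ i) (τ j) (ρ l)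

  SumOfSimple-transpose : ∀ {a b d} {T : Tensor F a b d} {r} →
                          SumOfSimple F T r → SumOfSimple F (λ j i l → T i j l) r
  SumOfSimple-transpose {r = r} (u , v , w , eq) =
    v , u , w , λ j i l → trans (eq i j l) (∑-cong r (λ t → *-congʳ (*-comm (u t i) (v t j))))

  eliminateHead : ∀ {a b d} → Tensor F (ℕ.suc a) b d → (Fin a → Carrier) → Tensor F a b d
  eliminateHead T k i j l = T (suc i) j l + k i * T zero j l

  eliminateHead-pivot : ∀ {a b d r} {T : Tensor F (ℕ.suc a) b d}
                        (sos : SumOfSimple F T (ℕ.suc r)) (t : Fin (ℕ.suc r)) →
                        ¬ proj₁ sos t zero ≈ 0# → ∃[ k ] SumOfSimple F (eliminateHead T k) r
  eliminateHead-pivot {r = r} {T} (u , v , w , eq) t α≉0 =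
    k , u′ , v ∘ punchIn t , w ∘ punchIn t , decomposition
    where
    α = u t zero
    β = proj₁ (inverse α α≉0)
    -- k i = − u_t(1+i) / u_t(0) cancels the pivot term t in slice 1+i
    k = λ i → - (u t (suc i) * β)
    u′ = λ s i → u (punchIn t s) (suc i) + k i * u (punchIn t s) zero

    decomposition : ∀ i j l → eliminateHead T k i j l ≈
                    ∑ r (λ s → u′ s i * v (punchIn t s) j * w (punchIn t s) l)
    decomposition i j l = begin
        T (suc i) j l + k i * T zero j l
      ≈⟨ +-cong (eq (suc i) j l) (*-congˡ (eq zero j l)) ⟩
        ∑ (ℕ.suc r) (λ s → term s (u s (suc i))) + k i * ∑ (ℕ.suc r) (λ s → term s (u s zero))
      ≈⟨ ∑-linear (ℕ.suc r) (λ s → term s (u s (suc i))) (λ s → term s (u s zero)) (k i) ⟩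
        ∑ (ℕ.suc r) (λ s → term s (u s (suc i)) + k i * term s (u s zero))
      ≈⟨ ∑-cong (ℕ.suc r) (λ s → xyz+k[wyz]≈[x+kw]yz (u s (suc i)) (v s j) (w s l) (k i) (u s zero)) ⟩
        ∑ (ℕ.suc r) (λ s → term s (u s (suc i) + k i * u s zero))
      ≈⟨ ∑-punchIn r t (λ s → term s (u s (suc i) + k i * u s zero)) ⟩
        term t (u t (suc i) + k i * α) + ∑ r (λ s → term (punchIn t s) (u′ s i))
      ≈⟨ +-congʳ (x≈0⇒x*y*z≈0 (v t j) (w t l) (x+[-xβ]α≈0 (u t (suc i)) (proj₂ (inverse α α≉0)))) ⟩
        0# + ∑ r (λ s → term (punchIn t s) (u′ s i))
      ≈⟨ +-identityˡ _ ⟩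
        ∑ r (λ s → term (punchIn t s) (u′ s i))
      ∎
      where
      term : Fin (ℕ.suc r) → Carrier → Carrier
      term s x = x * v s j * w s l

  eliminateHead-rank : ∀ {a b d r} {T : Tensor F (ℕ.suc a) b d} j₀ l₀ → ¬ T zero j₀ l₀ ≈ 0# →
                       SumOfSimple F T r →
                       ¬ ¬ (∃[ r′ ] r ≡ ℕ.suc r′ × ∃[ k ] SumOfSimple F (eliminateHead T k) r′)
  eliminateHead-rank {r = ℕ.zero}  j₀ l₀ T₀≉0 (_ , _ , _ , eq) = contradiction (eq zero j₀ l₀) T₀≉0
  eliminateHead-rank {r = ℕ.suc r} j₀ l₀ T₀≉0 sos@(u , v , w , eq) = do
    (t , term≉0) ← ∑≉0⇒∃≉0 (ℕ.suc r) (λ t → u t zero * v t j₀ * w t l₀) (T₀≉0 ∘ trans (eq zero j₀ l₀))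
    return (r , ≡.refl , eliminateHead-pivot sos t (term≉0 ∘ x≈0⇒x*y*z≈0 (v t j₀) (w t l₀)))

  AgreesWithLowerBlock : ∀ m {a b d} → Tensor F (m ℕ.+ a) b d → Tensor F a b d → Set ℓ
  AgreesWithLowerBlock m {a} T T′ =
    ∀ i j l → (∀ p → T (p ↑ˡ a) j l ≈ 0#) → T′ i j l ≈ T (m ↑ʳ i) j l

  eliminateBlock : ∀ m {a b d r} {T : Tensor F (m ℕ.+ a) b d} (J : Fin m → Fin b) (L : Fin m → Fin d) →
                   (∀ p q → T (p ↑ˡ a) (J q) (L q) ≈ δ F p q) → SumOfSimple F T r →
                   ¬ ¬ (∃[ r′ ] r ≡ m ℕ.+ r′ × ∃[ T′ ] SumOfSimple F T′ r′ × AgreesWithLowerBlock m T T′)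
  eliminateBlock ℕ.zero    {r = r} {T} _ _ _ sos = return (r , ≡.refl , T , sos , λ _ _ _ _ → refl)
  eliminateBlock (ℕ.suc m) {a} {T = T} J L T≈δ sos = do
    (r₁ , r≡ , k , sos₁) ← eliminateHead-rank (J zero) (L zero) (1≉0 ∘ trans (sym (T≈δ zero zero))) sos
    let below≈δ = λ p q → trans (y≈0⇒x+k*y≈x _ (k (p ↑ˡ a)) (T≈δ zero (suc q))) (T≈δ (suc p) (suc q))
    (r′ , r₁≡ , T′ , sos′ , agrees) ← eliminateBlock m (J ∘ suc) (L ∘ suc) below≈δ sos₁
    return (r′ , ≡.trans r≡ (≡.cong ℕ.suc r₁≡) , T′ , sos′ , λ i j l upper≈0 →
      trans (agrees i j l (λ p → trans (y≈0⇒x+k*y≈x _ (k (p ↑ˡ a)) (upper≈0 zero)) (upper≈0 (suc p))))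
            (y≈0⇒x+k*y≈x _ (k (m ↑ʳ i)) (upper≈0 zero)))

  δ-sym : ∀ {n} (p q : Fin n) → δ F p q ≡ δ F q p
  δ-sym zero    zero    = ≡.refl
  δ-sym zero    (suc q) = ≡.refl
  δ-sym (suc p) zero    = ≡.refl
  δ-sym (suc p) (suc q) = δ-sym p q

  module _ {n : ℕ} where
    blockI-↑ˡ-↑ˡ : ∀ (p q : Fin n) → blockI F {n} (p ↑ˡ n) (q ↑ˡ n) ≡ δ F p q
    blockI-↑ˡ-↑ˡ p q rewrite splitAt-↑ˡ n p n | splitAt-↑ˡ n q n = ≡.refl

    blockI-↑ˡ-↑ʳ : ∀ (p q : Fin n) → blockI F {n} (p ↑ˡ n) (n ↑ʳ q) ≡ 0#
    blockI-↑ˡ-↑ʳ p q rewrite splitAt-↑ˡ n p n | splitAt-↑ʳ n n q = ≡.refl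

    blockI-↑ʳ-↑ʳ : ∀ (p q : Fin n) → blockI F {n} (n ↑ʳ p) (n ↑ʳ q) ≡ δ F p q
    blockI-↑ʳ-↑ʳ p q rewrite splitAt-↑ʳ n n p | splitAt-↑ʳ n n q = ≡.refl

    blockA-↑ˡ : ∀ M (p : Fin n) j → blockA F {n} M (p ↑ˡ n) j ≡ 0#
    blockA-↑ˡ M p j rewrite splitAt-↑ˡ n p n = ≡.refl

    blockA-↑ʳ-↑ˡ : ∀ M (p q : Fin n) → blockA F {n} M (n ↑ʳ p) (q ↑ˡ n) ≡ M p q
    blockA-↑ʳ-↑ˡ M p q rewrite splitAt-↑ʳ n n p | splitAt-↑ˡ n q n = ≡.refl

    blockA-↑ʳ-↑ʳ : ∀ M (p q : Fin n) → blockA F {n} M (n ↑ʳ p) (n ↑ʳ q) ≡ 0#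
    blockA-↑ʳ-↑ʳ M p q rewrite splitAt-↑ʳ n n p | splitAt-↑ʳ n n q = ≡.refl

  tensor₁-elimination : ∀ {n k} (A : Fin k → Matrix F n n) {r} → SumOfSimple F (tensor₁ F A) r →
                        ¬ ¬ (∃[ r′ ] r ≡ n ℕ.+ (n ℕ.+ r′) × SumOfSimple F (layers F A) r′)
  tensor₁-elimination {n} A sos = do
    (r₁ , r≡ , T′ , sos₁ , T′-agrees) ←
      eliminateBlock n (_↑ˡ n) (λ _ → zero) (λ p q → reflexive (blockI-↑ˡ-↑ˡ p q)) sos
    (r′ , r₁≡ , U′ , sos′ , U′-agrees) ←
      eliminateBlock n id (λ _ → zero) (rightIdentity T′-agrees)
        (SumOfSimple-reindex (swapBlocks n) id id (SumOfSimple-transpose sos₁))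
    return (r′ , ≡.trans r≡ (≡.cong (n ℕ.+_) r₁≡) ,
            SumOfSimple-resp (layers≈ T′-agrees U′-agrees)
              (SumOfSimple-reindex id id suc (SumOfSimple-transpose sos′)))
    where
    T = tensor₁ F A

    upper≈0-at-right₀ : ∀ q p → T (p ↑ˡ n) (n ↑ʳ q) zero ≈ 0#
    upper≈0-at-right₀ q p = reflexive (blockI-↑ˡ-↑ʳ p q)

    upper≈0-at-layer₁₊ : ∀ j t p → T (p ↑ˡ n) j (suc t) ≈ 0#
    upper≈0-at-layer₁₊ j t p = reflexive (blockA-↑ˡ (A t) p j)

    rightIdentity : ∀ {T′} → AgreesWithLowerBlock n T T′ →
                    ∀ p q → T′ q (swapBlocks n (p ↑ˡ n)) zero ≈ δ F p q
    rightIdentity {T′} T′-agrees p q = begin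
      T′ q (swapBlocks n (p ↑ˡ n)) zero ≡⟨ ≡.cong (λ j → T′ q j zero) (swapBlocks-↑ˡ p) ⟩
      T′ q (n ↑ʳ p) zero                ≈⟨ T′-agrees q (n ↑ʳ p) zero (upper≈0-at-right₀ p) ⟩
      T (n ↑ʳ q) (n ↑ʳ p) zero          ≡⟨ blockI-↑ʳ-↑ʳ q p ⟩
      δ F q p                           ≡⟨ δ-sym q p ⟩
      δ F p q                           ∎

    layers≈ : ∀ {T′ U′} → AgreesWithLowerBlock n T T′ →
              AgreesWithLowerBlock n (λ j i l → T′ i (swapBlocks n j) l) U′ →
              ∀ i j t → layers F A i j t ≈ U′ j i (suc t)
    layers≈ {T′} {U′} T′-agrees U′-agrees i j t = sym (begin
      U′ j i (suc t)                       ≈⟨ U′-agrees j i (suc t) left≈0 ⟩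
      T′ i (swapBlocks n (n ↑ʳ j)) (suc t) ≡⟨ ≡.cong (λ j′ → T′ i j′ (suc t)) (swapBlocks-↑ʳ j) ⟩
      T′ i (j ↑ˡ n) (suc t)                ≈⟨ T′-agrees i (j ↑ˡ n) (suc t) (upper≈0-at-layer₁₊ (j ↑ˡ n) t) ⟩
      T (n ↑ʳ i) (j ↑ˡ n) (suc t)          ≡⟨ blockA-↑ʳ-↑ˡ (A t) i j ⟩
      A t i j                              ∎)
      where
      left≈0 : ∀ p → T′ i (swapBlocks n (p ↑ˡ n)) (suc t) ≈ 0#
      left≈0 p = begin
        T′ i (swapBlocks n (p ↑ˡ n)) (suc t) ≡⟨ ≡.cong (λ j′ → T′ i j′ (suc t)) (swapBlocks-↑ˡ p) ⟩
        T′ i (n ↑ʳ p) (suc t)                ≈⟨ T′-agrees i (n ↑ʳ p) (suc t) (upper≈0-at-layer₁₊ (n ↑ʳ p) t) ⟩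
        T (n ↑ʳ i) (n ↑ʳ p) (suc t)          ≡⟨ blockA-↑ʳ-↑ʳ (A t) i p ⟩
        0#                                   ∎

  blockI'-suc-↑ˡ : ∀ {n} (i j : Fin (n ℕ.+ n)) → blockI' F {n} (suc i) (j ↑ˡ 1) ≡ blockI F {n} i j
  blockI'-suc-↑ˡ {n} i j rewrite splitAt-↑ˡ (n ℕ.+ n) j 1 with splitAt n i | splitAt n j
  ... | inj₁ _ | inj₁ _ = ≡.refl
  ... | inj₁ _ | inj₂ _ = ≡.refl
  ... | inj₂ _ | inj₁ _ = ≡.refl
  ... | inj₂ _ | inj₂ _ = ≡.refl

  blockA'-suc-↑ˡ : ∀ {n} M (i j : Fin (n ℕ.+ n)) → blockA' F {n} M (suc i) (j ↑ˡ 1) ≡ blockA F {n} M i j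
  blockA'-suc-↑ˡ {n} M i j rewrite splitAt-↑ˡ (n ℕ.+ n) j 1 with splitAt n i | splitAt n j
  ... | inj₁ _ | inj₁ _ = ≡.refl
  ... | inj₁ _ | inj₂ _ = ≡.refl
  ... | inj₂ _ | inj₁ _ = ≡.refl
  ... | inj₂ _ | inj₂ _ = ≡.refl

  tensor₂-suc-↑ˡ : ∀ {n k} (A : Fin k → Matrix F n n) i j l →
                   tensor₂ F A (suc i) (j ↑ˡ 1) l ≡ tensor₁ F A i j l
  tensor₂-suc-↑ˡ {n} A i j zero    = blockI'-suc-↑ˡ {n} i j
  tensor₂-suc-↑ˡ {n} A i j (suc t) = blockA'-suc-↑ˡ {n} (A t) i j

  tensor₁-from-tensor₂ : ∀ {n k} (A : Fin k → Matrix F n n) {r} →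
                         SumOfSimple F (tensor₂ F A) r → SumOfSimple F (tensor₁ F A) r
  tensor₁-from-tensor₂ A sos =
    SumOfSimple-resp (λ i j l → reflexive (≡.sym (tensor₂-suc-↑ˡ A i j l)))
      (SumOfSimple-reindex suc (_↑ˡ 1) id sos)

open import Data.Nat using (_+_; _*_)
open import Data.Nat.Tactic.RingSolver using (solve-∀)

s+2n≤r : ∀ {s r r′} n → s ≤ r′ → r ≡ n + (n + r′) → s + 2 * n ≤ r
s+2n≤r {s} {r′ = r′} n s≤r′ ≡.refl =
  ≡.subst (s + 2 * n ≤_) (x+2y≡y+[y+x] r′ n) (+-monoˡ-≤ (2 * n) s≤r′)
  where
  x+2y≡y+[y+x] : ∀ x y → x + 2 * y ≡ y + (y + x)
  x+2y≡y+[y+x] = solve-∀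

lemma5p1 : ∀ {c ℓ : Level} (F : Field c ℓ) (n k : ℕ) (A : Fin k → Matrix F n n) →
    (∀ r s → IsRank F (tensor₁ F A) r → IsRank F (layers F A) s → s + 2 * n ≤ r)
    × (∀ r s → IsRank F (tensor₂ F A) r → IsRank F (layers F A) s → s + 2 * n ≤ r)
lemma5p1 F n k A =
    (λ r s (sos , _) → lowerBound sos)
  , (λ r s (sos , _) → lowerBound (tensor₁-from-tensor₂ A sos))
  where
  open RankBounds F

  lowerBound : ∀ {r s} → SumOfSimple F (tensor₁ F A) r → IsRank F (layers F A) s → s + 2 * n ≤ r
  lowerBound {r} {s} sos (_ , minimal) =
    decidable-stable (s + 2 * n ≤? r)
      (¬¬-map (λ (r′ , r≡ , sos′) → s+2n≤r n (minimal r′ sos′) r≡) (tensor₁-elimination A sos))
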